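{- Fix string indices $i,j$, row variables $x_i,x_j$ and a single column variable $a$. For every choice of a set $S$ of exactly three of the six external edges $\alpha,\beta,\gamma,\delta,\epsilon,\zeta$, the sum of the weights of all states of the left configuration $L$ with boundary condition $S$ equals the sum of the weights of all states of the right configuration $R$ with boundary condition $S$.
   Context: Each configuration has three vertices (oxygen atoms), three internal edges and six external edges labelled $\alpha,\beta,\gamma,\delta,\epsilon,\zeta$; every edge carries one hydrogen atom bonded to exactly one of its endpoints. The boundary condition $S$ specifies that the hydrogen on an external edge is bonded to the configuration's vertex on that edge iff the edge lies in $S$. A state is a choice, for each internal edge, of which endpoint its hydrogen is bonded to, such that every vertex is bonded to exactly two of the hydrogens on its four incident edges. The weight of a state is the product of the weights of its three vertices. Configuration $L$: a diagonal vertex $D$, an upper rectilinear vertex $U$ and a lower rectilinear vertex $W$. String $i$ enters $D$ through its south-west edge $\alpha$ (external) and leaves through its north-east edge, which is joined (internal edge) to the west edge of $U$; the east edge of $U$ is external $\delta$. String $j$ enters $D$ through its north-west edge $\beta$ (external) and leaves through its south-east edge, joined (internal edge) to the west edge of $W$; the east edge of $W$ is external $\epsilon$. A vertical line passes through $U$ and $W$: the north edge of $U$ is external $\gamma$, the south edge of $U$ and north edge of $W$ form an internal edge, the south edge of $W$ is external $\zeta$. Thus $U$ lies on string $i$ and $W$ on string $j$. Configuration $R$: an upper rectilinear vertex $U'$, a lower rectilinear vertex $W'$ and a diagonal vertex $D'$. The west edge of $U'$ is external $\beta$, the west edge of $W'$ is external $\alpha$, the north edge of $U'$ is external $\gamma$,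 the south edge of $W'$ is external $\zeta$, the south edge of $U'$ and north edge of $W'$ form an internal edge. The east edge of $W'$ is joined to the south-west edge of $D'$ and the east edge of $U'$ to the north-west edge of $D'$ (internal edges); the north-east edge of $D'$ is external $\delta$ and its south-east edge is external $\epsilon$. Thus string $i$ runs $\alpha\to W'\to D'$ (south-west to north-east) $\to\delta$, and string $j$ runs $\beta\to U'\to D'$ (north-west to south-east) $\to\epsilon$; $W'$ lies on string $i$ and $U'$ on string $j$. Weights of a rectilinear vertex on string $k\in\{i,j\}$ (with column variable $a$): $x_k/a$ if its two bonded hydrogens are on its north and south edges; $x_k/a-1$ if they are on its north and west edges; $1$ otherwise. Weights of a diagonal vertex (string $i$ running south-west to north-east, string $j$ north-west to south-east), according to the pair of edges carrying its two bonded hydrogens: south-west & north-east: $1/x_i$; north-west & south-east: $1/x_j$; north-west & north-east: $1/x_i-1/x_j$; south-west & south-east: $0$; south-east & north-east: $1/x_i$; south-west & north-west: $1/x_j$. -}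

module Defs where

open import Level using (Level)
open import Data.Bool using (Bool; true; false; not; if_then_else_; _∧_)
open import Data.Nat using (ℕ; zero; suc)
open import Algebra.Bundles using (CommutativeRing)

count4 : Bool → Bool → Bool → Bool → ℕ
count4 a b c d = c1 a (c1 b (c1 c (c1 d 0)))
  where
  c1 : Bool → ℕ → ℕ
  c1 true  n = suc n
  c1 false n = n

-- exactly two of four booleans are true (the ice rule at a vertex)
exactlyTwo : Bool → Bool → Bool → Bool → Bool
exactlyTwo a b c d with count4 a b c d
... | 2 = true
... | _ = false

data Ext : Set where
  α β γ δ ε ζ : Ext

-- A boundary condition: S e = true iff the hydrogen on external edge e
-- is bonded to the configuration's vertex on that edge.
Boundary : Set
Boundary = Ext → Bool

card : Boundary → ℕ
card S = cnt (S α) (cnt (S β) (cnt (S γ) (cnt (S δ) (cnt (S ε) (cnt (S ζ) 0)))))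
  where
  cnt : Bool → ℕ → ℕ
  cnt true  n = suc n
  cnt false n = n

module Weights {c ℓ : Level} (R : CommutativeRing c ℓ) where
  open CommutativeRing R

  -- Rectilinear vertex on string k: arguments are the row variable x_k,
  -- the inverse a⁻¹ of the column variable, and whether the hydrogens on
  -- the north, south, west, east edges are bonded to this vertex.
  -- (Only used when exactly two of them are bonded.)
  rectW : Carrier → Carrier → Bool → Bool → Bool → Bool → Carrier
  rectW xk ainv true  true  false false = xk * ainv
  rectW xk ainv true  false true  false = xk * ainv - 1#
  rectW xk ainv _     _     _     _     = 1#

  -- Diagonal vertex: arguments are 1/x_i, 1/x_j and whether the hydrogens
  -- on the south-west, north-west, north-east, south-east edges are bonded
  -- to this vertex. (Only used when exactly two of them are bonded.)
  diagW : Carrier → Carrier → Bool → Bool → Bool → Bool → Carrier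
  diagW xiinv xjinv true  false true  false = xiinv
  diagW xiinv xjinv false true  false true  = xjinv
  diagW xiinv xjinv false true  true  false = xiinv - xjinv
  diagW xiinv xjinv true  false false true  = 0#
  diagW xiinv xjinv false false true  true  = xiinv
  diagW xiinv xjinv true  true  false false = xjinv
  diagW xiinv xjinv _     _     _     _     = 0#

  -- sum over the 2^3 assignments of the three internal edges
  sum8 : (Bool → Bool → Bool → Carrier) → Carrier
  sum8 f = ((f false false false + f false false true)
         + (f false true false + f false true true))
         + ((f true false false + f true false true)
         + (f true true false + f true true true))

  -- Weight of an assignment: product of the vertex weights if every vertex
  -- satisfies the ice rule (i.e. the assignment is a state), 0 otherwise.
  guarded : Bool → Carrier → Carrier
  guarded b w = if b then w else 0#

  -- Internal edges:
  --   e1 : D(NE) — U(W);  s1 = true iff its hydrogen is bonded to D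
  --   e2 : D(SE) — W(W);  s2 = true iff its hydrogen is bonded to D
  --   e3 : U(S)  — W(N);  s3 = true iff its hydrogen is bonded to U
  -- D: SW = α, NW = β, NE = e1, SE = e2   (i: SW→NE, j: NW→SE)
  -- U (on string i): N = γ, S = e3, W = e1, E = δ
  -- W (on string j): N = e3, S = ζ, W = e2, E = ε
  weightL : (xi xj xiinv xjinv ainv : Carrier) → Boundary
          → Bool → Bool → Bool → Carrier
  weightL xi xj xiinv xjinv ainv S s1 s2 s3 =
    guarded (exactlyTwo (S α) (S β) s1 s2
             ∧ exactlyTwo (S γ) s3 (not s1) (S δ)
             ∧ exactlyTwo (not s3) (S ζ) (not s2) (S ε))
      (diagW xiinv xjinv (S α) (S β) s1 s2
       * rectW xi ainv (S γ) s3 (not s1) (S δ)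
       * rectW xj ainv (not s3) (S ζ) (not s2) (S ε))

  -- Internal edges:
  --   f1 : U'(S) — W'(N);  t1 = true iff its hydrogen is bonded to U'
  --   f2 : W'(E) — D'(SW); t2 = true iff its hydrogen is bonded to W'
  --   f3 : U'(E) — D'(NW); t3 = true iff its hydrogen is bonded to U'
  -- U' (on string j): N = γ, S = f1, W = β, E = f3
  -- W' (on string i): N = f1, S = ζ, W = α, E = f2
  -- D': SW = f2, NW = f3, NE = δ, SE = ε   (i: SW→NE, j: NW→SE)
  weightR : (xi xj xiinv xjinv ainv : Carrier) → Boundary
          → Bool → Bool → Bool → Carrier
  weightR xi xj xiinv xjinv ainv S t1 t2 t3 =
    guarded (exactlyTwo (S γ) t1 (S β) t3
             ∧ exactlyTwo (not t1) (S ζ) (S α) t2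
             ∧ exactlyTwo (not t2) (not t3) (S δ) (S ε))
      (rectW xj ainv (S γ) t1 (S β) t3
       * rectW xi ainv (not t1) (S ζ) (S α) t2
       * diagW xiinv xjinv (not t2) (not t3) (S δ) (S ε))

  ZL ZR : (xi xj xiinv xjinv ainv : Carrier) → Boundary → Carrier
  ZL xi xj xiinv xjinv ainv S = sum8 (weightL xi xj xiinv xjinv ainv S)
  ZR xi xj xiinv xjinv ainv S = sum8 (weightR xi xj xiinv xjinv ainv S)

module Submission where

-- Once the boundary S is fixed, ZL S and ZR S are polynomial expressions in
-- xi, xj and the "inverses" xi⁻¹, xj⁻¹, a⁻¹, treated as independent
-- variables.  For each of the 2⁶ boundaries, ZL S - ZR S is 0, 1 or -1 times
--     (xi · xi⁻¹ - xj · xj⁻¹) · a⁻¹,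
-- so it vanishes once xi · xi⁻¹ = xj · xj⁻¹ (for |S| ≠ 3 both sides are 0).

open import Level using (Level; 0ℓ; _⊔_)
open import Algebra.Bundles using (CommutativeRing)
open import Algebra.Bundles.Raw using (RawRing)
open import Algebra.Solver.Ring.AlmostCommutativeRing
  using (fromCommutativeRing; _-Raw-AlmostCommutative⟶_)
open import Data.Bool using (Bool; true; false; not)
open import Data.Fin using (#_)
open import Data.Maybe as Maybe using (Maybe; just; nothing; from-just; _<∣>_)
open import Data.Nat as ℕ using (ℕ; zero; suc; _∸_)
open import Data.Product using (_×_; _,_)
open import Data.Product.Properties using (≡-dec)
open import Data.Vec using (Vec; _∷_; [])
open import Relation.Binary.PropositionalEquality as ≡ using (_≡_)
open import Relation.Nullary using (yes; no)

open import Defs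

-- A ring solver for an arbitrary commutative ring R.  Coefficients are
-- pairs (m , n) of naturals standing for the integer m - n; they are
-- interpreted in R through the canonical map ℕ → R.
module IntegerCoefficients {c ℓ : Level} (R : CommutativeRing c ℓ) where
  open CommutativeRing R
  open import Algebra.Properties.Semiring.Mult.TCOptimised semiring
    using (1+×; ×-homo-+; ×1-homo-*) renaming (_×_ to _×′_)
  open import Algebra.Properties.Ring ring using (x[y-z]≈xy-xz; [y-z]x≈yx-zx)
  open import Algebra.Properties.Group +-group using (ε⁻¹≈ε)
  open import Algebra.Properties.AbelianGroup +-abelianGroup
    using (⁻¹-anti-homo‿-; ⁻¹-∙-comm)
  open import Algebra.Properties.CommutativeSemigroup +-commutativeSemigroup
    using (interchange)
  open import Relation.Binary.Reasoning.Setoid setoid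

  difference-+ : ∀ a b c d → (a - b) + (c - d) ≈ (a + c) - (b + d)
  difference-+ a b c d = trans (interchange a (- b) c (- d)) (+-congˡ (⁻¹-∙-comm b d))

  difference-* : ∀ a b c d → (a - b) * (c - d) ≈ (a * c + b * d) - (a * d + b * c)
  difference-* a b c d = begin
    (a - b) * (c - d)                   ≈⟨ [y-z]x≈yx-zx (c - d) a b ⟩
    a * (c - d) - b * (c - d)           ≈⟨ +-cong (x[y-z]≈xy-xz a c d) (-‿cong (x[y-z]≈xy-xz b c d)) ⟩
    (a * c - a * d) - (b * c - b * d)   ≈⟨ +-congˡ (⁻¹-anti-homo‿- (b * c) (b * d)) ⟩
    (a * c - a * d) + (b * d - b * c)   ≈⟨ difference-+ (a * c) (a * d) (b * d) (b * c) ⟩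
    (a * c + b * d) - (a * d + b * c)   ∎

  difference-cancelˡ : ∀ x a b → (x + a) - (x + b) ≈ a - b
  difference-cancelˡ x a b = begin
    (x + a) - (x + b)   ≈⟨ difference-+ x x a b ⟨
    (x - x) + (a - b)   ≈⟨ +-congʳ (-‿inverseʳ x) ⟩
    0# + (a - b)        ≈⟨ +-identityˡ (a - b) ⟩
    a - b               ∎

  ι : ℕ → Carrier
  ι n = n ×′ 1#

  -- Interpretation of the formal difference (m , n).  It first cancels
  -- common successors, so that closed coefficients such as (0 , 0) and
  -- (1 , 0) evaluate definitionally to 0# and 1#.
  ⟦_⟧ᵈ : ℕ × ℕ → Carrier
  ⟦ m     , zero  ⟧ᵈ = ι m
  ⟦ zero  , suc n ⟧ᵈ = - ι (suc n)
  ⟦ suc m , suc n ⟧ᵈ = ⟦ m , n ⟧ᵈ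

  ⟦⟧ᵈ-difference : ∀ m n → ⟦ m , n ⟧ᵈ ≈ ι m - ι n
  ⟦⟧ᵈ-difference m       zero    = sym (trans (+-congˡ ε⁻¹≈ε) (+-identityʳ (ι m)))
  ⟦⟧ᵈ-difference zero    (suc n) = sym (+-identityˡ (- ι (suc n)))
  ⟦⟧ᵈ-difference (suc m) (suc n) = begin
    ⟦ m , n ⟧ᵈ                 ≈⟨ ⟦⟧ᵈ-difference m n ⟩
    ι m - ι n                  ≈⟨ difference-cancelˡ 1# (ι m) (ι n) ⟨
    (1# + ι m) - (1# + ι n)    ≈⟨ +-cong (1+× m 1#) (-‿cong (1+× n 1#)) ⟨
    ι (suc m) - ι (suc n)      ∎

  Differences : RawRing 0ℓ 0ℓ
  Differences = record
    { Carrier = ℕ × ℕ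
    ; _≈_     = _≡_
    ; _+_     = λ { (a , b) (c , d) → (a ℕ.+ c , b ℕ.+ d) }
    ; _*_     = λ { (a , b) (c , d) → (a ℕ.* c ℕ.+ b ℕ.* d , a ℕ.* d ℕ.+ b ℕ.* c) }
    ; -_      = λ { (a , b) → (b , a) }
    ; 0#      = (0 , 0)
    ; 1#      = (1 , 0)
    }

  ⟦⟧ᵈ-+ : ∀ a b c d → ⟦ a ℕ.+ c , b ℕ.+ d ⟧ᵈ ≈ ⟦ a , b ⟧ᵈ + ⟦ c , d ⟧ᵈ
  ⟦⟧ᵈ-+ a b c d = begin
    ⟦ a ℕ.+ c , b ℕ.+ d ⟧ᵈ       ≈⟨ ⟦⟧ᵈ-difference (a ℕ.+ c) (b ℕ.+ d) ⟩
    ι (a ℕ.+ c) - ι (b ℕ.+ d)    ≈⟨ +-cong (×-homo-+ 1# a c) (-‿cong (×-homo-+ 1# b d)) ⟩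
    (ι a + ι c) - (ι b + ι d)    ≈⟨ difference-+ (ι a) (ι b) (ι c) (ι d) ⟨
    (ι a - ι b) + (ι c - ι d)    ≈⟨ +-cong (⟦⟧ᵈ-difference a b) (⟦⟧ᵈ-difference c d) ⟨
    ⟦ a , b ⟧ᵈ + ⟦ c , d ⟧ᵈ      ∎

  ⟦⟧ᵈ-* : ∀ a b c d →
          ⟦ a ℕ.* c ℕ.+ b ℕ.* d , a ℕ.* d ℕ.+ b ℕ.* c ⟧ᵈ ≈ ⟦ a , b ⟧ᵈ * ⟦ c , d ⟧ᵈ
  ⟦⟧ᵈ-* a b c d = begin
    ⟦ a ℕ.* c ℕ.+ b ℕ.* d , a ℕ.* d ℕ.+ b ℕ.* c ⟧ᵈ
      ≈⟨ ⟦⟧ᵈ-difference (a ℕ.* c ℕ.+ b ℕ.* d) (a ℕ.* d ℕ.+ b ℕ.* c) ⟩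
    ι (a ℕ.* c ℕ.+ b ℕ.* d) - ι (a ℕ.* d ℕ.+ b ℕ.* c)
      ≈⟨ +-cong (ι-sum-of-products a c b d) (-‿cong (ι-sum-of-products a d b c)) ⟩
    (ι a * ι c + ι b * ι d) - (ι a * ι d + ι b * ι c)
      ≈⟨ difference-* (ι a) (ι b) (ι c) (ι d) ⟨
    (ι a - ι b) * (ι c - ι d)
      ≈⟨ *-cong (⟦⟧ᵈ-difference a b) (⟦⟧ᵈ-difference c d) ⟨
    ⟦ a , b ⟧ᵈ * ⟦ c , d ⟧ᵈ ∎
    where
    ι-sum-of-products : ∀ p q r s → ι (p ℕ.* q ℕ.+ r ℕ.* s) ≈ ι p * ι q + ι r * ι s
    ι-sum-of-products p q r s =
      trans (×-homo-+ 1# (p ℕ.* q) (r ℕ.* s)) (+-cong (×1-homo-* p q) (×1-homo-* r s))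

  ⟦⟧ᵈ-negate : ∀ a b → ⟦ b , a ⟧ᵈ ≈ - ⟦ a , b ⟧ᵈ
  ⟦⟧ᵈ-negate a b = begin
    ⟦ b , a ⟧ᵈ      ≈⟨ ⟦⟧ᵈ-difference b a ⟩
    ι b - ι a       ≈⟨ ⁻¹-anti-homo‿- (ι a) (ι b) ⟨
    - (ι a - ι b)   ≈⟨ -‿cong (⟦⟧ᵈ-difference a b) ⟨
    - ⟦ a , b ⟧ᵈ    ∎

  interpretation : Differences -Raw-AlmostCommutative⟶ fromCommutativeRing R
  interpretation = record
    { ⟦_⟧    = ⟦_⟧ᵈ
    ; +-homo = λ { (a , b) (c , d) → ⟦⟧ᵈ-+ a b c d }
    ; *-homo = λ { (a , b) (c , d) → ⟦⟧ᵈ-* a b c d }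
    ; -‿homo = λ { (a , b) → ⟦⟧ᵈ-negate a b }
    ; 0-homo = refl
    ; 1-homo = refl
    }

  -- Equal integers have the same reduced representative (m ∸ n , n ∸ m);
  -- comparing representatives decides equality of coefficients.
  canonical : ℕ × ℕ → ℕ × ℕ
  canonical (m , n) = (m ∸ n , n ∸ m)

  ⟦⟧ᵈ-canonical : ∀ x → ⟦ x ⟧ᵈ ≡ ⟦ canonical x ⟧ᵈ
  ⟦⟧ᵈ-canonical (zero  , zero ) = ≡.refl
  ⟦⟧ᵈ-canonical (suc m , zero ) = ≡.refl
  ⟦⟧ᵈ-canonical (zero  , suc n) = ≡.refl
  ⟦⟧ᵈ-canonical (suc m , suc n) = ⟦⟧ᵈ-canonical (m , n)

  _≟ᵈ_ : ∀ x y → Maybe (⟦ x ⟧ᵈ ≈ ⟦ y ⟧ᵈ)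
  x ≟ᵈ y with ≡-dec ℕ._≟_ ℕ._≟_ (canonical x) (canonical y)
  ... | yes same = just (reflexive (≡.trans (⟦⟧ᵈ-canonical x)
                                   (≡.trans (≡.cong ⟦_⟧ᵈ same) (≡.sym (⟦⟧ᵈ-canonical y)))))
  ... | no _     = nothing

  open import Algebra.Solver.Ring Differences (fromCommutativeRing R) interpretation _≟ᵈ_ public

-- Polynomial expressions in n variables, identified when they agree under
-- every valuation, form a commutative ring: it is the pull-back of the
-- pointwise ring of functions Env n → R along evaluation.
module Expressions {c ℓ : Level} (R : CommutativeRing c ℓ) (n : ℕ) where
  open CommutativeRing R using (_≈_; refl)
  open IntegerCoefficients R
  import Algebra.Construct.Pointwise (Env n) as Pointwise
  open import Algebra.Morphism.Structures using (IsRingMonomorphism)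
  import Algebra.Morphism.RingMonomorphism as RingMonomorphism

  Expressionsᴿ : RawRing 0ℓ (c ⊔ ℓ)
  Expressionsᴿ = record
    { Carrier = Polynomial n
    ; _≈_     = λ p q → ∀ ρ → ⟦ p ⟧ ρ ≈ ⟦ q ⟧ ρ
    ; _+_     = _:+_
    ; _*_     = _:*_
    ; -_      = :-_
    ; 0#      = con (0 , 0)
    ; 1#      = con (1 , 0)
    }

  Functions : CommutativeRing c (c ⊔ ℓ)
  Functions = Pointwise.commutativeRing R

  evaluation : IsRingMonomorphism Expressionsᴿ (CommutativeRing.rawRing Functions) ⟦_⟧
  evaluation = record
    { isRingHomomorphism = record
      { isSemiringHomomorphism = record
        { isNearSemiringHomomorphism = record
          { +-isMonoidHomomorphism = record
            { isMagmaHomomorphism = record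
              { isRelHomomorphism = record { cong = λ p≈q → p≈q }
              ; homo = λ _ _ _ → refl
              }
            ; ε-homo = λ _ → refl
            }
          ; *-homo = λ _ _ _ → refl
          }
        ; 1#-homo = λ _ → refl
        }
      ; -‿homo = λ _ _ → refl
      }
    ; injective = λ p≈q → p≈q
    }

  Expressions : CommutativeRing 0ℓ (c ⊔ ℓ)
  Expressions = record
    { isCommutativeRing = RingMonomorphism.isCommutativeRing evaluation
                            (CommutativeRing.isCommutativeRing Functions)
    }

module Evaluation {c ℓ : Level} (R : CommutativeRing c ℓ) {n : ℕ}
                  (ρ : Vec (CommutativeRing.Carrier R) n) where
  open CommutativeRing R
  open IntegerCoefficients R using (Polynomial; ⟦_⟧)
  open Expressions R n using (Expressions)
  private
    module W = Weights R
    module P = Weights Expressions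

  rectW-eval : ∀ x a nb sb wb eb →
               ⟦ P.rectW x a nb sb wb eb ⟧ ρ ≈ W.rectW (⟦ x ⟧ ρ) (⟦ a ⟧ ρ) nb sb wb eb
  rectW-eval x a true  true  false false = refl
  rectW-eval x a true  false true  false = refl
  rectW-eval x a false _     _     _     = refl
  rectW-eval x a true  true  true  _     = refl
  rectW-eval x a true  true  false true  = refl
  rectW-eval x a true  false false _     = refl
  rectW-eval x a true  false true  true  = refl

  diagW-eval : ∀ x y sw nw ne se →
               ⟦ P.diagW x y sw nw ne se ⟧ ρ ≈ W.diagW (⟦ x ⟧ ρ) (⟦ y ⟧ ρ) sw nw ne se
  diagW-eval x y true  false true  false = refl
  diagW-eval x y false true  false true  = refl
  diagW-eval x y false true  true  false = refl
  diagW-eval x y true  false false true  = refl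
  diagW-eval x y false false true  true  = refl
  diagW-eval x y true  true  false false = refl
  diagW-eval x y true  false true  true  = refl
  diagW-eval x y true  false false false = refl
  diagW-eval x y true  true  true  _     = refl
  diagW-eval x y true  true  false true  = refl
  diagW-eval x y false true  false false = refl
  diagW-eval x y false true  true  true  = refl
  diagW-eval x y false false false _     = refl
  diagW-eval x y false false true  false = refl

  guarded-eval : ∀ b {p x} → ⟦ p ⟧ ρ ≈ x → ⟦ P.guarded b p ⟧ ρ ≈ W.guarded b x
  guarded-eval true  p≈x = p≈x
  guarded-eval false _   = refl

  sum8-eval : ∀ (f : Bool → Bool → Bool → Polynomial n) g →
              (∀ s t u → ⟦ f s t u ⟧ ρ ≈ g s t u) → ⟦ P.sum8 f ⟧ ρ ≈ W.sum8 g
  sum8-eval f g f≈g =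
    +-cong (+-cong (+-cong (f≈g _ _ _) (f≈g _ _ _)) (+-cong (f≈g _ _ _) (f≈g _ _ _)))
           (+-cong (+-cong (f≈g _ _ _) (f≈g _ _ _)) (+-cong (f≈g _ _ _) (f≈g _ _ _)))

  ZL-eval : ∀ xi xj Xi Xj A S →
            ⟦ P.ZL xi xj Xi Xj A S ⟧ ρ ≈ W.ZL (⟦ xi ⟧ ρ) (⟦ xj ⟧ ρ) (⟦ Xi ⟧ ρ) (⟦ Xj ⟧ ρ) (⟦ A ⟧ ρ) S
  ZL-eval xi xj Xi Xj A S = sum8-eval (P.weightL xi xj Xi Xj A S)
      (W.weightL (⟦ xi ⟧ ρ) (⟦ xj ⟧ ρ) (⟦ Xi ⟧ ρ) (⟦ Xj ⟧ ρ) (⟦ A ⟧ ρ) S) λ s₁ s₂ s₃ →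
    guarded-eval _
      (*-cong (*-cong (diagW-eval Xi Xj (S α) (S β) s₁ s₂)
                      (rectW-eval xi A (S γ) s₃ (not s₁) (S δ)))
              (rectW-eval xj A (not s₃) (S ζ) (not s₂) (S ε)))

  ZR-eval : ∀ xi xj Xi Xj A S →
            ⟦ P.ZR xi xj Xi Xj A S ⟧ ρ ≈ W.ZR (⟦ xi ⟧ ρ) (⟦ xj ⟧ ρ) (⟦ Xi ⟧ ρ) (⟦ Xj ⟧ ρ) (⟦ A ⟧ ρ) S
  ZR-eval xi xj Xi Xj A S = sum8-eval (P.weightR xi xj Xi Xj A S)
      (W.weightR (⟦ xi ⟧ ρ) (⟦ xj ⟧ ρ) (⟦ Xi ⟧ ρ) (⟦ Xj ⟧ ρ) (⟦ A ⟧ ρ) S) λ t₁ t₂ t₃ →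
    guarded-eval _
      (*-cong (*-cong (rectW-eval xj A (S γ) t₁ (S β) t₃)
                      (rectW-eval xi A (not t₁) (S ζ) (S α) t₂))
              (diagW-eval Xi Xj (not t₂) (not t₃) (S δ) (S ε)))

allBools : ∀ {p} {P : Bool → Set p} → (∀ b → Maybe (P b)) → Maybe (∀ b → P b)
allBools decide with decide false | decide true
... | just pf | just pt = just λ { false → pf ; true → pt }
... | _       | _       = nothing

boundary : Bool → Bool → Bool → Bool → Bool → Bool → Boundary
boundary a b g d e z α = a
boundary a b g d e z β = b
boundary a b g d e z γ = g
boundary a b g d e z δ = d
boundary a b g d e z ε = e
boundary a b g d e z ζ = z

allBoundaries : ∀ {p} {P : Boundary → Set p} → (∀ S → Maybe (P S)) →
                Maybe (∀ a b g d e z → P (boundary a b g d e z))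
allBoundaries decide =
  allBools λ a → allBools λ b → allBools λ g → allBools λ d → allBools λ e → allBools λ z →
  decide (boundary a b g d e z)

-- The polynomial identities behind the theorem, in the variables
-- xi, xj, xi⁻¹, xj⁻¹, a⁻¹ (written x̂i, x̂j, X̂i, X̂j, Â), checked by
-- normalisation.
module Verification {c ℓ : Level} (R : CommutativeRing c ℓ) where
  open CommutativeRing R
  open IntegerCoefficients R
  open Expressions R 5 using (Expressions)
  open import Relation.Binary.Reasoning.Setoid setoid
  private module P = Weights Expressions

  x̂i x̂j X̂i X̂j Â : Polynomial 5
  x̂i = var (# 0)
  x̂j = var (# 1)
  X̂i = var (# 2)
  X̂j = var (# 3)
  Â  = var (# 4)

  ZLᴾ ZRᴾ : Boundary → Polynomial 5
  ZLᴾ = P.ZL x̂i x̂j X̂i X̂j Â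
  ZRᴾ = P.ZR x̂i x̂j X̂i X̂j Â

  -- The only relation between the variables the move relies on.
  defect : Polynomial 5
  defect = (x̂i :* X̂i :- x̂j :* X̂j) :* Â

  Agree : Boundary → Set (c ⊔ ℓ)
  Agree S = ∀ ρ → ⟦ defect ⟧ ρ ≈ 0# → ⟦ ZLᴾ S ⟧ ρ ≈ ⟦ ZRᴾ S ⟧ ρ

  agreesModulo : ∀ S (m : Polynomial 5) → Maybe (Agree S)
  agreesModulo S m = Maybe.map agree (normalise (ZLᴾ S) ≟N normalise (ZRᴾ S :+ m :* defect))
    where
    agree : normalise (ZLᴾ S) ≈N normalise (ZRᴾ S :+ m :* defect) → Agree S
    agree normal-forms ρ defect≈0 = begin
      ⟦ ZLᴾ S ⟧ ρ                           ≈⟨ prove ρ (ZLᴾ S) (ZRᴾ S :+ m :* defect)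
                                                   (⟦ normal-forms ⟧N-cong ρ) ⟩
      ⟦ ZRᴾ S ⟧ ρ + ⟦ m ⟧ ρ * ⟦ defect ⟧ ρ  ≈⟨ +-congˡ (trans (*-congˡ defect≈0) (zeroʳ _)) ⟩
      ⟦ ZRᴾ S ⟧ ρ + 0#                      ≈⟨ +-identityʳ _ ⟩
      ⟦ ZRᴾ S ⟧ ρ                           ∎

  -- The multiple of the defect is always 0, 1 or -1.
  agree? : ∀ S → Maybe (Agree S)
  agree? S = agreesModulo S (con (0 , 0))
         <∣> agreesModulo S (con (1 , 0))
         <∣> agreesModulo S (con (0 , 1))

  agreeEverywhere : ∀ a b g d e z → Agree (boundary a b g d e z)
  agreeEverywhere = from-just (allBoundaries agree?)

module StarTriangle {c ℓ : Level} (R : CommutativeRing c ℓ) where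
  open CommutativeRing R
  open Weights R
  open IntegerCoefficients R using (⟦_⟧)
  open Verification R
  open import Algebra.Properties.Group +-group using (x≈y⇒x∙y⁻¹≈ε)
  open import Relation.Binary.Reasoning.Setoid setoid

  ZL≈ZR : ∀ xi xj xiinv xjinv ainv → xi * xiinv ≈ xj * xjinv → ∀ S →
          ZL xi xj xiinv xjinv ainv S ≈ ZR xi xj xiinv xjinv ainv S
  ZL≈ZR xi xj xiinv xjinv ainv same S = begin
    ZL xi xj xiinv xjinv ainv S  ≈⟨ ZL-eval x̂i x̂j X̂i X̂j Â S ⟨
    ⟦ ZLᴾ S ⟧ ρ                  ≈⟨ agreeEverywhere (S α) (S β) (S γ) (S δ) (S ε) (S ζ)
                                      ρ defect-vanishes ⟩
    ⟦ ZRᴾ S ⟧ ρ                  ≈⟨ ZR-eval x̂i x̂j X̂i X̂j Â S ⟩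
    ZR xi xj xiinv xjinv ainv S  ∎
    where
    ρ : Vec Carrier 5
    ρ = xi ∷ xj ∷ xiinv ∷ xjinv ∷ ainv ∷ []
    open Evaluation R ρ using (ZL-eval; ZR-eval)
    defect-vanishes : (xi * xiinv - xj * xjinv) * ainv ≈ 0#
    defect-vanishes = trans (*-congʳ (x≈y⇒x∙y⁻¹≈ε same)) (zeroˡ ainv)

-- Both products xi · xi⁻¹ and xj · xj⁻¹ equal 1, so the star-triangle
-- relation applies.
mainTheorem3 : ∀ {c ℓ : Level} (R : CommutativeRing c ℓ) →
    let open CommutativeRing R in
    ∀ (xi xj a xiinv xjinv ainv : Carrier) →
    xi * xiinv ≈ 1# → xj * xjinv ≈ 1# → a * ainv ≈ 1# →
    (S : Boundary) → card S ≡ 3 →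
    Weights.ZL R xi xj xiinv xjinv ainv S ≈ Weights.ZR R xi xj xiinv xjinv ainv S
mainTheorem3 R xi xj a xiinv xjinv ainv xi-inverse xj-inverse _ S _ =
  StarTriangle.ZL≈ZR R xi xj xiinv xjinv ainv (trans xi-inverse (sym xj-inverse)) S
  where open CommutativeRing R using (trans; sym)
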